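{- Let $r\ge2$ and $n>T_r=r(r+1)/2$. Then the induced subgraph $G_n^{[r]}$ of $G_n$ on $V_{n,r}=\{\lambda\vdash n:\sigma(\lambda)=r\}$ contains an edge.
   Context: $G_n$ is the partition graph: its vertices are the partitions of $n$, and two distinct partitions $\lambda\neq\mu$ are adjacent when $\mu$ is obtained from $\lambda$ by moving one cell from one part (of size $x$, the part shrinking to $x-1$ and disappearing if $x=1$) to another part or to a new part of size $1$, followed by reordering the parts in weakly decreasing order. $\sigma(\lambda)$ is the number of distinct part sizes of $\lambda$. -}

module Defs where

open import Data.Nat using (ℕ; zero; suc; _+_; _<_; _≥_; _≟_)
open import Data.List using (List; []; _∷_; length; deduplicate)
open import Data.Nat.ListAction using (sum)
open import Data.Nat using (_*_)
open import Data.Nat.DivMod using (_/_)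
open import Data.List.Relation.Unary.All using (All)
open import Data.List.Relation.Unary.Linked using (Linked)
open import Data.List.Relation.Binary.Permutation.Propositional using (_↭_)
open import Data.Product using (_×_; ∃-syntax)
open import Data.Sum using (_⊎_)
open import Relation.Binary.PropositionalEquality using (_≡_)
open import Relation.Nullary using (¬_)

record IsPartition (n : ℕ) (λs : List ℕ) : Set where
  field
    decreasing : Linked _≥_ λs
    positive   : All (0 <_) λs
    total      : sum λs ≡ n

σ : List ℕ → ℕ
σ λs = length (deduplicate _≟_ λs)

_⊕_ : ℕ → List ℕ → List ℕ
zero  ⊕ ys = ys
suc x ⊕ ys = suc x ∷ ys

-- One-cell move from λ to μ (as multisets of parts; reordering = permutation):
--  * from a part x+1 to another part y:  λ ↭ (x+1) ∷ y ∷ rest,  μ ↭ (y+1) ∷ (x ⊕ rest)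
--  * from a part x+1 to a new part 1:    λ ↭ (x+1) ∷ rest,      μ ↭ 1 ∷ (x ⊕ rest)
Move : List ℕ → List ℕ → Set
Move λs μs =
  (∃[ x ] ∃[ y ] ∃[ rest ] (λs ↭ suc x ∷ y ∷ rest) × (μs ↭ suc y ∷ (x ⊕ rest)))
  ⊎ (∃[ x ] ∃[ rest ] (λs ↭ suc x ∷ rest) × (μs ↭ 1 ∷ (x ⊕ rest)))

Adjacent : List ℕ → List ℕ → Set
Adjacent λs μs = ¬ (λs ≡ μs) × Move λs μs

T : ℕ → ℕ
T r = r * (r + 1) / 2

{-# OPTIONS --safe #-}
module Submission where

open import Defs
open import Function using (_∘_)
open import Data.Nat using (ℕ; zero; suc; _+_; _*_; _/_; _≟_; _≤_; _<_; _≥_; s≤s; z≤n)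
open import Data.Nat.Properties
  using (≤-refl; ≤-trans; n≤1+n; m≤n⇒m≤1+n; m≤m+n; ≤-<-trans; >⇒≢; 1+n≢n; *-distribʳ-+; m≤n⇒∃[o]m+o≡n)
open import Data.Nat.DivMod using (m*n/n≡m)
open import Data.Nat.ListAction using (sum)
open import Data.Nat.ListAction.Properties using (sum-++)
open import Data.Nat.Tactic.RingSolver using (solve-∀)
open import Data.List using (List; []; _∷_; _∷ʳ_; length)
open import Data.List.Properties using (filter-all; ∷-injectiveˡ)
open import Data.List.Relation.Unary.All as All using (All; []; _∷_)
open import Data.List.Relation.Unary.All.Properties using (deduplicate⁺; ∷ʳ⁺)
open import Data.List.Relation.Unary.Linked using (Linked; [-]; _∷_)
open import Data.List.Relation.Binary.Permutation.Propositional using (↭-refl; ↭-sym)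
open import Data.List.Relation.Binary.Permutation.Propositional.Properties using (∷↭∷ʳ)
open import Data.Product using (_×_; _,_; ∃-syntax)
open import Data.Sum using (inj₂)
open import Relation.Nullary using (¬?)
open import Relation.Binary.PropositionalEquality
  using (_≡_; _≢_; refl; cong; subst; module ≡-Reasoning)

-- For n = T r + 1 + k the edge joins λ = (r+k+1, r−1, r−2, …, 1) to
-- μ = (r+k, r−1, r−2, …, 1, 1): a cell moves from the largest part to a new
-- part 1. Both have r distinct part sizes: 1 already occurs in λ since r ≥ 2,
-- and the largest part r+k exceeds every other part.

HasEdge : ℕ → ℕ → Set
HasEdge r n = ∃[ λs ] ∃[ μs ] IsPartition n λs × IsPartition n μs ×
  σ λs ≡ r × σ μs ≡ r × Adjacent λs μs

σ-∷-fresh : ∀ {a xs} → All (a ≢_) xs → σ (a ∷ xs) ≡ suc (σ xs)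
σ-∷-fresh {a} a∉xs = cong (suc ∘ length) (filter-all (¬? ∘ (a ≟_)) (deduplicate⁺ _≟_ a∉xs))

σ-∷-larger : ∀ {a xs} → All (_< a) xs → σ (a ∷ xs) ≡ suc (σ xs)
σ-∷-larger = σ-∷-fresh ∘ All.map >⇒≢

move-to-new-part : ∀ c xs → Adjacent (suc (suc c) ∷ xs) (suc c ∷ xs ∷ʳ 1)
move-to-new-part c xs =
  (λ eq → 1+n≢n (∷-injectiveˡ eq)) ,
  inj₂ (suc c , xs , ↭-refl , ↭-sym (∷↭∷ʳ 1 (suc c ∷ xs)))

staircase : ℕ → List ℕ
staircase zero    = []
staircase (suc m) = suc m ∷ staircase m

staircase-sum : ∀ m → sum (staircase m) ≡ T m
staircase-sum m = begin
  sum (staircase m)           ≡⟨ m*n/n≡m (sum (staircase m)) 2 ⟨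
  sum (staircase m) * 2 / 2   ≡⟨ cong (_/ 2) (twice-sum m) ⟩
  m * (m + 1) / 2             ∎
  where
  open ≡-Reasoning
  twice-sum : ∀ m → sum (staircase m) * 2 ≡ m * (m + 1)
  twice-sum zero    = refl
  twice-sum (suc m) = begin
    (suc m + sum (staircase m)) * 2        ≡⟨ *-distribʳ-+ 2 (suc m) (sum (staircase m)) ⟩
    suc m * 2 + sum (staircase m) * 2      ≡⟨ cong (suc m * 2 +_) (twice-sum m) ⟩
    suc m * 2 + m * (m + 1)                ≡⟨ gauss-step m ⟩
    suc m * (suc m + 1)                    ∎
    where
    gauss-step : ∀ m → suc m * 2 + m * (m + 1) ≡ suc m * (suc m + 1)
    gauss-step = solve-∀

T-suc : ∀ m → T (suc m) ≡ suc m + T m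
T-suc m = begin
  T (suc m)                       ≡⟨ staircase-sum (suc m) ⟨
  suc m + sum (staircase m)       ≡⟨ cong (suc m +_) (staircase-sum m) ⟩
  suc m + T m                     ∎
  where open ≡-Reasoning

staircase-positive : ∀ m → All (0 <_) (staircase m)
staircase-positive zero    = []
staircase-positive (suc m) = s≤s z≤n ∷ staircase-positive m

staircase-< : ∀ {a} m → m < a → All (_< a) (staircase m)
staircase-< zero    _   = []
staircase-< (suc m) 1+m<a = 1+m<a ∷ staircase-< m (≤-<-trans (n≤1+n m) 1+m<a)

∷-staircase-decreasing : ∀ {a} m → m ≤ a → Linked _≥_ (a ∷ staircase m)
∷-staircase-decreasing zero    _   = [-]
∷-staircase-decreasing (suc m) 1+m≤a = 1+m≤a ∷ ∷-staircase-decreasing m (n≤1+n m)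

∷-staircase∷ʳ1-decreasing : ∀ {a} m → 1 ≤ a → m ≤ a → Linked _≥_ (a ∷ staircase m ∷ʳ 1)
∷-staircase∷ʳ1-decreasing zero    1≤a _   = 1≤a ∷ [-]
∷-staircase∷ʳ1-decreasing (suc m) _   1+m≤a = 1+m≤a ∷ ∷-staircase∷ʳ1-decreasing m (s≤s z≤n) (n≤1+n m)

σ-∷-staircase : ∀ {a} m → m < a → σ (a ∷ staircase m) ≡ suc m
σ-∷-staircase zero    _   = refl
σ-∷-staircase {a} (suc m) 1+m<a = begin
  σ (a ∷ staircase (suc m))        ≡⟨ σ-∷-larger (staircase-< (suc m) 1+m<a) ⟩
  suc (σ (suc m ∷ staircase m))    ≡⟨ cong suc (σ-∷-staircase m ≤-refl) ⟩
  suc (suc m)                      ∎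
  where open ≡-Reasoning

σ-∷-staircase∷ʳ1 : ∀ {a} m → suc m < a → σ (a ∷ staircase (suc m) ∷ʳ 1) ≡ suc (suc m)
σ-∷-staircase∷ʳ1 zero    1<a = σ-∷-larger (1<a ∷ 1<a ∷ [])
σ-∷-staircase∷ʳ1 {a} (suc m) 2+m<a = begin
  σ (a ∷ staircase (suc (suc m)) ∷ʳ 1)
    ≡⟨ σ-∷-larger (∷ʳ⁺ (staircase-< (suc (suc m)) 2+m<a) (≤-trans (s≤s (s≤s z≤n)) 2+m<a)) ⟩
  suc (σ (suc (suc m) ∷ staircase (suc m) ∷ʳ 1))
    ≡⟨ cong suc (σ-∷-staircase∷ʳ1 m ≤-refl) ⟩
  suc (suc (suc m))
    ∎
  where open ≡-Reasoning

∷-staircase-isPartition : ∀ {a} m → m ≤ suc a → IsPartition (suc a + T m) (suc a ∷ staircase m)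
∷-staircase-isPartition {a} m m≤1+a = record
  { decreasing = ∷-staircase-decreasing m m≤1+a
  ; positive   = s≤s z≤n ∷ staircase-positive m
  ; total      = cong (suc a +_) (staircase-sum m)
  }

∷-staircase∷ʳ1-isPartition : ∀ {a} m → m ≤ suc a → IsPartition (suc (suc a) + T m) (suc a ∷ staircase m ∷ʳ 1)
∷-staircase∷ʳ1-isPartition {a} m m≤1+a = record
  { decreasing = ∷-staircase∷ʳ1-decreasing m (s≤s z≤n) m≤1+a
  ; positive   = s≤s z≤n ∷ ∷ʳ⁺ (staircase-positive m) (s≤s z≤n)
  ; total      = begin
      suc a + sum (staircase m ∷ʳ 1)        ≡⟨ cong (suc a +_) (sum-++ (staircase m) (1 ∷ [])) ⟩
      suc a + (sum (staircase m) + 1)       ≡⟨ cong (λ s → suc a + (s + 1)) (staircase-sum m) ⟩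
      suc a + (T m + 1)                     ≡⟨ shift-one a (T m) ⟩
      suc (suc a) + T m                     ∎
  }
  where
  open ≡-Reasoning
  shift-one : ∀ a t → suc a + (t + 1) ≡ suc (suc a) + t
  shift-one = solve-∀

staircase-edge : ∀ p c → p < c → HasEdge (suc (suc p)) (suc (suc c) + T (suc p))
staircase-edge p c p<c =
  suc (suc c) ∷ staircase (suc p) , suc c ∷ staircase (suc p) ∷ʳ 1 ,
  ∷-staircase-isPartition (suc p) (m≤n⇒m≤1+n 1+p≤1+c) ,
  ∷-staircase∷ʳ1-isPartition (suc p) 1+p≤1+c ,
  σ-∷-staircase (suc p) (s≤s 1+p≤1+c) ,
  σ-∷-staircase∷ʳ1 p (s≤s p<c) ,
  move-to-new-part c (staircase (suc p))
  where
  1+p≤1+c : suc p ≤ suc c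
  1+p≤1+c = m≤n⇒m≤1+n p<c

proposition6p4 : (r n : ℕ) → 2 ≤ r → T r < n →
    ∃[ λs ] ∃[ μs ] IsPartition n λs × IsPartition n μs ×
      σ λs ≡ r × σ μs ≡ r × Adjacent λs μs
proposition6p4 (suc (suc p)) n (s≤s (s≤s z≤n)) T<n with m≤n⇒∃[o]m+o≡n T<n
... | k , 1+T+k≡n =
  subst (HasEdge (suc (suc p))) size (staircase-edge p (suc p + k) (m≤m+n (suc p) k))
  where
  open ≡-Reasoning
  regroup : ∀ q k t → suc (suc (q + k)) + t ≡ suc (suc q + t) + k
  regroup = solve-∀
  size : suc (suc (suc p + k)) + T (suc p) ≡ n
  size = begin
    suc (suc (suc p + k)) + T (suc p)   ≡⟨ regroup (suc p) k (T (suc p)) ⟩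
    suc (suc (suc p) + T (suc p)) + k   ≡⟨ cong (λ t → suc t + k) (T-suc (suc p)) ⟨
    suc (T (suc (suc p))) + k           ≡⟨ 1+T+k≡n ⟩
    n                                   ∎
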